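{- Let $\Sigma$ be a connected $(X,2)$-arc-transitive graph of valency $4$ and let $\Delta$ be a self-paired $X$-orbit on $Arc_3(\Sigma)$. Then $\gimel(\Sigma,\Delta)\cong\Psi(\Sigma,J(\Delta))$.
   Context: Graphs are finite, simple, undirected; $\Sigma(\tau)$ is a neighbourhood. A $3$-arc is a sequence $(\alpha_0,\ldots,\alpha_3)$ of vertices with consecutive ones adjacent and $\alpha_0\ne\alpha_2$, $\alpha_1\ne\alpha_3$; $Arc_3(\Sigma)$ is their set. A $2$-path $[\alpha_0,\alpha_1,\alpha_2]$ is a sequence of three distinct vertices with $\alpha_1$ adjacent to $\alpha_0,\alpha_2$, identified with its reverse; $Path_2(\Sigma)$ is their set. $\Sigma$ is $(X,2)$-arc-transitive if $X$ acts preserving adjacency, transitively on vertices and on $2$-arcs. $\Delta$ is self-paired if closed under reversal. $\gimel(\Sigma,\Delta)$ has vertex set $Path_2(\Sigma)$ and edges $\{[\alpha_0,\alpha_1,\alpha_2],[\alpha_1,\alpha_2,\alpha_3]\}$ for $(\alpha_0,\ldots,\alpha_3)\in\Delta$. For a $3$-arc $\boldsymbol\alpha=(\tau_1,\tau,\sigma,\sigma_1)$ with $\Sigma(\tau)=\{\sigma,\tau_1,\tau_2,\tau_3\}$ and $\Sigma(\sigma)=\{\tau,\sigma_1,\sigma_2,\sigma_3\}$, let $J_{\boldsymbol\alpha}=([\tau_2,\tau,\tau_3],[\sigma_2,\sigma,\sigma_3])$, and $J(\Delta)=\{J_{\boldsymbol\alpha}:\boldsymbol\alpha\in\Delta\}$.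 $\Psi(\Sigma,J(\Delta))$ is the graph with vertex set $Path_2(\Sigma)$ in which $\boldsymbol\tau,\boldsymbol\sigma$ are adjacent iff $(\boldsymbol\tau,\boldsymbol\sigma)\in J(\Delta)$. -}

module Defs where

open import Level using (Level; _⊔_) renaming (suc to lsuc)
open import Data.Nat using (ℕ)
open import Data.Bool using (Bool; T; false)
open import Data.Fin using (Fin; _<_)
open import Data.List using (length; filterᵇ; allFin)
open import Data.Product using (Σ; ∃; _×_; _,_)
open import Data.Sum using (_⊎_)
open import Relation.Binary.PropositionalEquality using (_≡_; _≢_)
open import Relation.Binary.Construct.Closure.ReflexiveTransitive using (Star)
open import Algebra.Bundles using (Group)
open import Function.Bundles using (_⇔_)
open import Function.Definitions using (Bijective)

record Graph : Set where
  field
    n      : ℕ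
    adj    : Fin n → Fin n → Bool
    sym    : ∀ u v → adj u v ≡ adj v u
    irrefl : ∀ v → adj v v ≡ false

module _ (Γ : Graph) where
  open Graph Γ

  V : Set
  V = Fin n

  _~_ : V → V → Set
  u ~ v = T (adj u v)

  degree : V → ℕ
  degree v = length (filterᵇ (adj v) (allFin n))

  HasValency : ℕ → Set
  HasValency k = ∀ v → degree v ≡ k

  Connected : Set
  Connected = ∀ u v → Star _~_ u v

  Is2Arc : V → V → V → Set
  Is2Arc a₀ a₁ a₂ = a₀ ~ a₁ × a₁ ~ a₂ × a₀ ≢ a₂

  record Quad : Set where
    constructor ⟨_,_,_,_⟩
    field
      q₀ q₁ q₂ q₃ : V

  open Quad public

  IsArc3 : Quad → Set
  IsArc3 ⟨ a₀ , a₁ , a₂ , a₃ ⟩ =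
    a₀ ~ a₁ × a₁ ~ a₂ × a₂ ~ a₃ × a₀ ≢ a₂ × a₁ ≢ a₃

  reverseQ : Quad → Quad
  reverseQ ⟨ a₀ , a₁ , a₂ , a₃ ⟩ = ⟨ a₃ , a₂ , a₁ , a₀ ⟩

  -- 2-paths [a,b,c] (identified with [c,b,a]); canonical representative
  -- chosen with a < c (so in particular a ≢ c).
  record Path2 : Set where
    constructor path2
    field
      pa pb pc : V
      pa~pb    : pa ~ pb
      pb~pc    : pb ~ pc
      pa<pc    : pa < pc

  open Path2 public

  Rep : Path2 → V → V → V → Set
  Rep p x y z = (pa p ≡ x × pb p ≡ y × pc p ≡ z)
              ⊎ (pa p ≡ z × pb p ≡ y × pc p ≡ x)

record GraphAction {c ℓ : Level} (Γ : Graph) (X : Group c ℓ) : Set (c ⊔ ℓ) where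
  open Group X
  field
    act      : Carrier → V Γ → V Γ
    act-cong : ∀ {g h} → g ≈ h → ∀ v → act g v ≡ act h v
    act-ε    : ∀ v → act ε v ≡ v
    act-∙    : ∀ g h v → act (g ∙ h) v ≡ act g (act h v)
    act-adj  : ∀ g u v → Graph.adj Γ (act g u) (act g v) ≡ Graph.adj Γ u v

  actQ : Carrier → Quad Γ → Quad Γ
  actQ g ⟨ a₀ , a₁ , a₂ , a₃ ⟩ = ⟨ act g a₀ , act g a₁ , act g a₂ , act g a₃ ⟩

module _ {c ℓ : Level} {Γ : Graph} {X : Group c ℓ} (A : GraphAction Γ X) where
  open GraphAction A
  open Group X using (Carrier)

  VertexTransitive : Set c
  VertexTransitive = ∀ u v → ∃ λ (g : Carrier) → act g u ≡ v

  TwoArcTransitive : Set c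
  TwoArcTransitive = ∀ a₀ a₁ a₂ b₀ b₁ b₂ →
    Is2Arc Γ a₀ a₁ a₂ → Is2Arc Γ b₀ b₁ b₂ →
    ∃ λ (g : Carrier) → act g a₀ ≡ b₀ × act g a₁ ≡ b₁ × act g a₂ ≡ b₂

  Is2ArcTransitive : Set c
  Is2ArcTransitive = VertexTransitive × TwoArcTransitive

  IsArc3Orbit : {d : Level} → (Quad Γ → Set d) → Set (c ⊔ d)
  IsArc3Orbit Δ = ∃ λ α → IsArc3 Γ α ×
    (∀ β → Δ β ⇔ (∃ λ (g : Carrier) → β ≡ actQ g α))

module _ (Γ : Graph) where

  SelfPaired : {d : Level} → (Quad Γ → Set d) → Set d
  SelfPaired Δ = ∀ β → Δ β → Δ (reverseQ Γ β)

  GimelAdj : {d : Level} → (Quad Γ → Set d) → Path2 Γ → Path2 Γ → Set d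
  GimelAdj Δ p q = ∃ λ α → Δ α ×
      ((Rep Γ p (q₀ α) (q₁ α) (q₂ α) × Rep Γ q (q₁ α) (q₂ α) (q₃ α))
     ⊎ (Rep Γ q (q₀ α) (q₁ α) (q₂ α) × Rep Γ p (q₁ α) (q₂ α) (q₃ α)))

  -- (p , q) = J_α for α = (τ₁,τ,σ,σ₁): p = [τ₂,τ,τ₃] where
  -- Σ(τ) = {σ,τ₁,τ₂,τ₃}, and q = [σ₂,σ,σ₃] where Σ(σ) = {τ,σ₁,σ₂,σ₃}.
  IsJ : Quad Γ → Path2 Γ → Path2 Γ → Set
  IsJ ⟨ τ₁ , τ , σ , σ₁ ⟩ p q =
      (pb p ≡ τ × pa p ~' τ × pc p ~' τ
        × pa p ≢ σ × pa p ≢ τ₁ × pc p ≢ σ × pc p ≢ τ₁)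
    × (pb q ≡ σ × pa q ~' σ × pc q ~' σ
        × pa q ≢ τ × pa q ≢ σ₁ × pc q ≢ τ × pc q ≢ σ₁)
    where
      _~'_ : V Γ → V Γ → Set
      _~'_ = _~_ Γ

  PsiAdj : {d : Level} → (Quad Γ → Set d) → Path2 Γ → Path2 Γ → Set d
  PsiAdj Δ p q = ∃ λ α → Δ α × IsJ α p q

  Isomorphic : {d e : Level} → (Path2 Γ → Path2 Γ → Set d) →
               (Path2 Γ → Path2 Γ → Set e) → Set (d ⊔ e)
  Isomorphic R S = Σ (Path2 Γ → Path2 Γ) λ φ →
    Bijective _≡_ _≡_ φ × (∀ p q → R p q ⇔ S (φ p) (φ q))

-- The isomorphism is the complement map on 2-paths: for a 2-path [a,b,c]
-- the neighbourhood Σ(b) has exactly two further vertices x, y, and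
-- [a,b,c] ↦ [x,b,y].  This map is an involution, hence a bijection of
-- Path₂(Σ).  For a 3-arc α = (α₀,α₁,α₂,α₃) the complements of [α₀,α₁,α₂]
-- and [α₁,α₂,α₃] form exactly the pair J_α, so ℷ-edges are carried onto
-- pairs in J(Δ); self-pairedness of Δ handles the two orientations of an
-- ℷ-edge, and conversely a pair J_α with α ∈ Δ (a 3-arc) pulls back to
-- the ℷ-edge of α.

module Submission where

open import Defs
open import Level using (Level)
open import Algebra.Bundles using (Group)

open import Data.Nat using (ℕ)
open import Data.Bool using (T)
open import Data.Bool.Properties using (T-irrelevant; T?)
open import Data.Fin using (Fin; _<_)
open import Data.Fin.Properties using (_≟_; all?; any?; <-cmp; <⇒≢; <-asym; <-irrelevant)
open import Data.List using (List; lookup; filter; allFin)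
import Data.List.Relation.Unary.All as All
open import Data.List.Relation.Unary.AllPairs using (_∷_)
open import Data.List.Relation.Unary.Any using (index)
open import Data.List.Relation.Unary.Any.Properties using (lookup-index)
open import Data.List.Relation.Unary.Unique.Propositional using (Unique)
import Data.List.Relation.Unary.Unique.Propositional.Properties as Unique
open import Data.List.Membership.Propositional using (_∈_)
open import Data.List.Membership.Propositional.Properties
  using (∈-filter⁺; ∈-filter⁻; ∈-allFin; ∈-lookup)
open import Data.Product using (∃; ∃₂; _×_; _,_; proj₁; proj₂)
open import Data.Sum using (_⊎_; inj₁; inj₂)
open import Function using (_∘_)
open import Function.Bundles using (mk⇔; Equivalence)
open import Function.Definitions using (Bijective)
open import Function.Consequences.Propositional
  using (inverseᵇ⇒bijective; strictlyInverseˡ⇒inverseˡ; strictlyInverseʳ⇒inverseʳ)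
open import Relation.Nullary using (Dec; ¬?; contradiction)
open import Relation.Nullary.Decidable using (_→-dec_; _⊎-dec_; _×-dec_; toWitness)
open import Relation.Binary using (tri<; tri≈; tri>)
open import Relation.Binary.PropositionalEquality
  using (_≡_; _≢_; refl; sym; trans; cong; subst; subst₂; module ≡-Reasoning)

involution-bijective : ∀ {a} {A : Set a} (f : A → A) → (∀ x → f (f x) ≡ x) →
  Bijective _≡_ _≡_ f
involution-bijective f inv =
  inverseᵇ⇒bijective (strictlyInverseˡ⇒inverseˡ f inv , strictlyInverseʳ⇒inverseʳ f inv)

lookup-injective : ∀ {a} {A : Set a} {xs : List A} → Unique xs →
  ∀ i j → lookup xs i ≡ lookup xs j → i ≡ j
lookup-injective (_ ∷ _) Fin.zero Fin.zero _ = refl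
lookup-injective (x≢ ∷ _) Fin.zero (Fin.suc j) e = contradiction e (All.lookup x≢ (∈-lookup j))
lookup-injective (x≢ ∷ _) (Fin.suc i) Fin.zero e = contradiction (sym e) (All.lookup x≢ (∈-lookup i))
lookup-injective (_ ∷ u) (Fin.suc i) (Fin.suc j) e = cong Fin.suc (lookup-injective u i j e)

TwoOthers : (i j : Fin 4) → Set
TwoOthers i j = ∃₂ λ k l → k ≢ l × k ≢ i × k ≢ j × l ≢ i × l ≢ j

two-others? : (i j : Fin 4) → Dec (i ≢ j → TwoOthers i j)
two-others? i j = ¬? (i ≟ j) →-dec (any? λ k → any? λ l →
  ¬? (k ≟ l) ×-dec ¬? (k ≟ i) ×-dec ¬? (k ≟ j) ×-dec ¬? (l ≟ i) ×-dec ¬? (l ≟ j))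

-- Both exhaustive checks are abstract, so later goals never re-run them.
abstract
  two-others : ∀ i j → i ≢ j → TwoOthers i j
  two-others = toWitness {a? = all? λ i → all? λ j → two-others? i j} _

OnlyTwoOthers : (i j k l m : Fin 4) → Set
OnlyTwoOthers i j k l m = i ≢ j → k ≢ l → k ≢ i → k ≢ j → l ≢ i → l ≢ j →
  m ≢ i → m ≢ j → m ≡ k ⊎ m ≡ l

only-two-others? : (i j k l m : Fin 4) → Dec (OnlyTwoOthers i j k l m)
only-two-others? i j k l m =
  ¬? (i ≟ j) →-dec ¬? (k ≟ l) →-dec ¬? (k ≟ i) →-dec ¬? (k ≟ j) →-dec
  ¬? (l ≟ i) →-dec ¬? (l ≟ j) →-dec ¬? (m ≟ i) →-dec ¬? (m ≟ j) →-dec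
  ((m ≟ k) ⊎-dec (m ≟ l))

abstract
  only-two-others : ∀ i j k l m → OnlyTwoOthers i j k l m
  only-two-others = toWitness
    {a? = all? λ i → all? λ j → all? λ k → all? λ l → all? λ m → only-two-others? i j k l m} _

module Neighbourhoods (Γ : Graph) where
  open Graph Γ using (n; adj)

  infix 4 _∼_
  _∼_ : V Γ → V Γ → Set
  _∼_ = _~_ Γ

  ∼-sym : ∀ {u v} → u ∼ v → v ∼ u
  ∼-sym {u} {v} = subst T (Graph.sym Γ u v)

  -- s, t, x, y are four distinct neighbours of b.  Under valency 4 they
  -- exhaust Σ(b), so {x,y} is the complement of {s,t} in Σ(b).
  record Splits (b s t x y : V Γ) : Set where
    field
      b∼s : b ∼ s
      b∼t : b ∼ t
      b∼x : b ∼ x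
      b∼y : b ∼ y
      s≢t : s ≢ t
      x≢y : x ≢ y
      x≢s : x ≢ s
      x≢t : x ≢ t
      y≢s : y ≢ s
      y≢t : y ≢ t

  splits-swap : ∀ {b s t x y} → Splits b s t x y → Splits b x y s t
  splits-swap S = record
    { b∼s = b∼x ; b∼t = b∼y ; b∼x = b∼s ; b∼y = b∼t ; s≢t = x≢y ; x≢y = s≢t
    ; x≢s = x≢s ∘ sym ; x≢t = y≢s ∘ sym ; y≢s = x≢t ∘ sym ; y≢t = y≢t ∘ sym }
    where open Splits S

  record Enumeration (b : V Γ) (k : ℕ) : Set where
    field
      nb      : Fin k → V Γ
      nb-inj  : ∀ i j → nb i ≡ nb j → i ≡ j
      nb-adj  : ∀ i → b ∼ nb i
      nb-onto : ∀ {v} → b ∼ v → ∃ λ i → nb i ≡ v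

  enumerate : ∀ b → Enumeration b (degree Γ b)
  enumerate b = record
    { nb      = lookup neighbours
    ; nb-inj  = lookup-injective (Unique.filter⁺ adjacent? (Unique.allFin⁺ n))
    ; nb-adj  = λ i → proj₂ (∈-filter⁻ adjacent? {xs = allFin n} (∈-lookup i))
    ; nb-onto = λ b∼v → let v∈ = ∈-filter⁺ adjacent? (∈-allFin _) b∼v in
                         index v∈ , sym (lookup-index v∈) }
    where
      adjacent? : ∀ v → Dec (b ∼ v)
      adjacent? = T? ∘ adj b

      neighbours : List (V Γ)
      neighbours = filter adjacent? (allFin n)

  module FourNeighbours {b : V Γ} (E : Enumeration b 4) where
    open Enumeration E

    slot : ∀ {v} → b ∼ v → Fin 4
    slot b∼v = proj₁ (nb-onto b∼v)

    nb-slot : ∀ {v} (b∼v : b ∼ v) → nb (slot b∼v) ≡ v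
    nb-slot b∼v = proj₂ (nb-onto b∼v)

    slot-injective : ∀ {u v} (b∼u : b ∼ u) (b∼v : b ∼ v) → slot b∼u ≡ slot b∼v → u ≡ v
    slot-injective b∼u b∼v e = trans (sym (nb-slot b∼u)) (trans (cong nb e) (nb-slot b∼v))

    slot-≢ : ∀ {u v} (b∼u : b ∼ u) (b∼v : b ∼ v) → u ≢ v → slot b∼u ≢ slot b∼v
    slot-≢ b∼u b∼v u≢v = u≢v ∘ slot-injective b∼u b∼v

    nb-≢ : ∀ {i v} (b∼v : b ∼ v) → i ≢ slot b∼v → nb i ≢ v
    nb-≢ {i} b∼v i≢ e = i≢ (nb-inj i (slot b∼v) (trans e (sym (nb-slot b∼v))))

    splits-exists : ∀ {s t} → b ∼ s → b ∼ t → s ≢ t → ∃₂ (Splits b s t)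
    splits-exists b∼s b∼t s≢t
      with two-others (slot b∼s) (slot b∼t) (slot-≢ b∼s b∼t s≢t)
    ... | k , l , k≢l , k≢s , k≢t , l≢s , l≢t = nb k , nb l , record
      { b∼s = b∼s ; b∼t = b∼t ; b∼x = nb-adj k ; b∼y = nb-adj l ; s≢t = s≢t
      ; x≢y = k≢l ∘ nb-inj k l
      ; x≢s = nb-≢ b∼s k≢s ; x≢t = nb-≢ b∼t k≢t
      ; y≢s = nb-≢ b∼s l≢s ; y≢t = nb-≢ b∼t l≢t }

    splits-complete : ∀ {s t x y z} → Splits b s t x y →
      b ∼ z → z ≢ s → z ≢ t → z ≡ x ⊎ z ≡ y
    splits-complete S b∼z z≢s z≢t
      with only-two-others (slot b∼s) (slot b∼t) (slot b∼x) (slot b∼y) (slot b∼z)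
             (slot-≢ b∼s b∼t s≢t) (slot-≢ b∼x b∼y x≢y)
             (slot-≢ b∼x b∼s x≢s) (slot-≢ b∼x b∼t x≢t)
             (slot-≢ b∼y b∼s y≢s) (slot-≢ b∼y b∼t y≢t)
             (slot-≢ b∼z b∼s z≢s) (slot-≢ b∼z b∼t z≢t)
      where open Splits S
    ... | inj₁ e = inj₁ (slot-injective b∼z (Splits.b∼x S) e)
    ... | inj₂ e = inj₂ (slot-injective b∼z (Splits.b∼y S) e)

module TwoPaths (Γ : Graph) where
  open Neighbourhoods Γ using (_∼_; ∼-sym)

  -- A 2-path is determined by its vertices (the proofs are irrelevant).
  path2-ext : ∀ {p q : Path2 Γ} → pa p ≡ pa q → pb p ≡ pb q → pc p ≡ pc q → p ≡ q
  path2-ext {path2 a b c a∼b b∼c a<c} {path2 .a .b .c a∼b′ b∼c′ a<c′} refl refl refl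
    rewrite T-irrelevant a∼b a∼b′ | T-irrelevant b∼c b∼c′ | <-irrelevant a<c a<c′ = refl

  pb∼pa : (p : Path2 Γ) → pb p ∼ pa p
  pb∼pa p = ∼-sym (pa~pb p)

  pa≢pc : (p : Path2 Γ) → pa p ≢ pc p
  pa≢pc p = <⇒≢ (pa<pc p)

  rep-self : (p : Path2 Γ) → Rep Γ p (pa p) (pb p) (pc p)
  rep-self p = inj₁ (refl , refl , refl)

  rep-swap : ∀ {p x b y} → Rep Γ p x b y → Rep Γ p y b x
  rep-swap (inj₁ e) = inj₂ e
  rep-swap (inj₂ e) = inj₁ e

  -- [x,b,y] names at most one 2-path: the canonical orientation is unique.
  rep-unique : ∀ {p q x b y} → Rep Γ p x b y → Rep Γ q x b y → p ≡ q
  rep-unique (inj₁ (a , b , c)) (inj₁ (a′ , b′ , c′)) =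
    path2-ext (trans a (sym a′)) (trans b (sym b′)) (trans c (sym c′))
  rep-unique (inj₂ (a , b , c)) (inj₂ (a′ , b′ , c′)) =
    path2-ext (trans a (sym a′)) (trans b (sym b′)) (trans c (sym c′))
  rep-unique {p} {q} (inj₁ (a , _ , c)) (inj₂ (a′ , _ , c′)) =
    contradiction (subst₂ _<_ a c (pa<pc p)) (<-asym (subst₂ _<_ a′ c′ (pa<pc q)))
  rep-unique {p} {q} (inj₂ (a , _ , c)) (inj₁ (a′ , _ , c′)) =
    contradiction (subst₂ _<_ a c (pa<pc p)) (<-asym (subst₂ _<_ a′ c′ (pa<pc q)))

  make : (x b y : V Γ) → b ∼ x → b ∼ y → x ≢ y → Path2 Γ
  make x b y b∼x b∼y x≢y with <-cmp x y
  ... | tri< x<y _ _ = path2 x b y (∼-sym b∼x) b∼y x<y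
  ... | tri≈ _ x≡y _ = contradiction x≡y x≢y
  ... | tri> _ _ y<x = path2 y b x (∼-sym b∼y) b∼x y<x

  make-rep : ∀ x b y b∼x b∼y x≢y → Rep Γ (make x b y b∼x b∼y x≢y) x b y
  make-rep x b y b∼x b∼y x≢y with <-cmp x y
  ... | tri< _ _ _ = inj₁ (refl , refl , refl)
  ... | tri≈ _ x≡y _ = contradiction x≡y x≢y
  ... | tri> _ _ _ = inj₂ (refl , refl , refl)

module Complements (Γ : Graph) (valency4 : HasValency Γ 4) where
  open Neighbourhoods Γ
  open TwoPaths Γ

  enumeration₄ : ∀ b → Enumeration b 4
  enumeration₄ b = subst (Enumeration b) (valency4 b) (enumerate b)

  other-two : ∀ b {s t} → b ∼ s → b ∼ t → s ≢ t → ∃₂ (Splits b s t)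
  other-two b = FourNeighbours.splits-exists (enumeration₄ b)

  only-other-two : ∀ {b s t x y z} → Splits b s t x y → b ∼ z → z ≢ s → z ≢ t → z ≡ x ⊎ z ≡ y
  only-other-two {b} = FourNeighbours.splits-complete (enumeration₄ b)

  -- q = [x,b,y] is a 2-path with centre b whose endpoints avoid s and t.
  -- Under valency 4 this says {x,y} = Σ(b) ∖ {s,t}.
  record ComplementAt (b s t : V Γ) (q : Path2 Γ) : Set where
    field
      centre : pb q ≡ b
      a∼b    : pa q ∼ b
      c∼b    : pc q ∼ b
      a≢s    : pa q ≢ s
      a≢t    : pa q ≢ t
      c≢s    : pc q ≢ s
      c≢t    : pc q ≢ t

  -- the form in which ComplementAt occurs in IsJ
  complementAt-flat : ∀ {b s t q} → ComplementAt b s t q →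
    pb q ≡ b × pa q ∼ b × pc q ∼ b × pa q ≢ s × pa q ≢ t × pc q ≢ s × pc q ≢ t
  complementAt-flat C = centre , a∼b , c∼b , a≢s , a≢t , c≢s , c≢t
    where open ComplementAt C

  flat-complementAt : ∀ {b s t q} →
    pb q ≡ b × pa q ∼ b × pc q ∼ b × pa q ≢ s × pa q ≢ t × pc q ≢ s × pc q ≢ t →
    ComplementAt b s t q
  flat-complementAt (e , a∼b , c∼b , a≢s , a≢t , c≢s , c≢t) =
    record { centre = e ; a∼b = a∼b ; c∼b = c∼b ; a≢s = a≢s ; a≢t = a≢t ; c≢s = c≢s ; c≢t = c≢t }

  complementAt-swap : ∀ {b s t q} → ComplementAt b s t q → ComplementAt b t s q
  complementAt-swap C = record
    { centre = centre ; a∼b = a∼b ; c∼b = c∼b ; a≢s = a≢t ; a≢t = a≢s ; c≢s = c≢t ; c≢t = c≢s }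
    where open ComplementAt C

  complementAt-centre : ∀ {b b′ s t q} → b ≡ b′ → ComplementAt b s t q → ComplementAt b′ s t q
  complementAt-centre refl C = C

  complementAt-splits : ∀ {b s t q} → b ∼ s → b ∼ t → s ≢ t →
    ComplementAt b s t q → Splits b s t (pa q) (pc q)
  complementAt-splits {q = q} b∼s b∼t s≢t C = record
    { b∼s = b∼s ; b∼t = b∼t ; b∼x = ∼-sym a∼b ; b∼y = ∼-sym c∼b ; s≢t = s≢t
    ; x≢y = pa≢pc q ; x≢s = a≢s ; x≢t = a≢t ; y≢s = c≢s ; y≢t = c≢t }
    where open ComplementAt C

  complementAt-rep : ∀ {b s t x y q} → Splits b s t x y → ComplementAt b s t q → Rep Γ q x b y
  complementAt-rep {q = q} S C
    with only-other-two S (∼-sym a∼b) a≢s a≢t | only-other-two S (∼-sym c∼b) c≢s c≢t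
    where open ComplementAt C
  ... | inj₁ a≡x | inj₁ c≡x = contradiction (trans a≡x (sym c≡x)) (pa≢pc q)
  ... | inj₁ a≡x | inj₂ c≡y = inj₁ (a≡x , ComplementAt.centre C , c≡y)
  ... | inj₂ a≡y | inj₁ c≡x = inj₂ (a≡y , ComplementAt.centre C , c≡x)
  ... | inj₂ a≡y | inj₂ c≡y = contradiction (trans a≡y (sym c≡y)) (pa≢pc q)

  rep-complementAt : ∀ {b s t x y} q → Splits b s t x y → Rep Γ q x b y → ComplementAt b s t q
  rep-complementAt q S (inj₁ (refl , refl , refl)) = record
    { centre = refl ; a∼b = ∼-sym b∼x ; c∼b = ∼-sym b∼y
    ; a≢s = x≢s ; a≢t = x≢t ; c≢s = y≢s ; c≢t = y≢t }
    where open Splits S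
  rep-complementAt q S (inj₂ (refl , refl , refl)) = record
    { centre = refl ; a∼b = ∼-sym b∼y ; c∼b = ∼-sym b∼x
    ; a≢s = y≢s ; a≢t = y≢t ; c≢s = x≢s ; c≢t = x≢t }
    where open Splits S

  Complementary : Path2 Γ → Path2 Γ → Set
  Complementary p = ComplementAt (pb p) (pa p) (pc p)

  complementary-splits : ∀ p q → Complementary p q → Splits (pb p) (pa p) (pc p) (pa q) (pc q)
  complementary-splits p q = complementAt-splits (pb∼pa p) (pb~pc p) (pa≢pc p)

  complementary-sym : ∀ p q → Complementary p q → Complementary q p
  complementary-sym p q C =
    complementAt-centre (sym (ComplementAt.centre C))
      (rep-complementAt p (splits-swap (complementary-splits p q C)) (rep-self p))

  complementary-unique : ∀ p q r → Complementary p q → Complementary p r → q ≡ r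
  complementary-unique p q r Cq Cr = rep-unique (complementAt-rep S Cq) (complementAt-rep S Cr)
    where S = complementary-splits p q Cq

  second-pair : ∀ {b s t x y} → Splits b s t x y → Path2 Γ
  second-pair {b} {x = x} {y = y} S = make x b y (Splits.b∼x S) (Splits.b∼y S) (Splits.x≢y S)

  second-pair-complementAt : ∀ {b s t x y} (S : Splits b s t x y) → ComplementAt b s t (second-pair S)
  second-pair-complementAt {b} {x = x} {y = y} S =
    rep-complementAt (second-pair S) S (make-rep x b y (Splits.b∼x S) (Splits.b∼y S) (Splits.x≢y S))

  splitting : ∀ p → ∃₂ (Splits (pb p) (pa p) (pc p))
  splitting p = other-two (pb p) (pb∼pa p) (pb~pc p) (pa≢pc p)

  -- The complement map on Path₂(Σ): [a,b,c] ↦ [x,b,y] with Σ(b) = {a,c,x,y}.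
  complement : Path2 Γ → Path2 Γ
  complement p = second-pair (proj₂ (proj₂ (splitting p)))

  complement-complementary : ∀ p → Complementary p (complement p)
  complement-complementary p = second-pair-complementAt (proj₂ (proj₂ (splitting p)))

  -- being complementary is symmetric and unique, so the map is an involution
  complement-involutive : ∀ p → complement (complement p) ≡ p
  complement-involutive p =
    complementary-unique (complement p) (complement (complement p)) p
      (complement-complementary (complement p))
      (complementary-sym p (complement p) (complement-complementary p))

  complement-of-rep : ∀ p {a b c} → Rep Γ p a b c → ComplementAt b c a (complement p)
  complement-of-rep p (inj₁ (refl , refl , refl)) = complementAt-swap (complement-complementary p)
  complement-of-rep p (inj₂ (refl , refl , refl)) = complement-complementary p

  rep-of-complement : ∀ p {a b c} → b ∼ a → b ∼ c → a ≢ c →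
    ComplementAt b c a (complement p) → Rep Γ p a b c
  rep-of-complement p b∼a b∼c a≢c C =
    rep-swap {p} (complementAt-rep (splits-swap (complementAt-splits b∼c b∼a (a≢c ∘ sym) C))
                               (complementAt-centre (ComplementAt.centre C)
                                  (complementary-sym p (complement p) (complement-complementary p))))

module Orbits {c ℓ : Level} {Γ : Graph} {X : Group c ℓ} (A : GraphAction Γ X) where
  open GraphAction A
  open Group X using (_∙_; _⁻¹; ε; inverseˡ)
  open Neighbourhoods Γ using (_∼_)
  open ≡-Reasoning

  act-cancel : ∀ g v → act (g ⁻¹) (act g v) ≡ v
  act-cancel g v = begin
    act (g ⁻¹) (act g v) ≡⟨ sym (act-∙ (g ⁻¹) g v) ⟩
    act (g ⁻¹ ∙ g) v     ≡⟨ act-cong (inverseˡ g) v ⟩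
    act ε v              ≡⟨ act-ε v ⟩
    v                    ∎

  act-injective : ∀ g {u v} → act g u ≡ act g v → u ≡ v
  act-injective g {u} {v} e = begin
    u                    ≡⟨ sym (act-cancel g u) ⟩
    act (g ⁻¹) (act g u) ≡⟨ cong (act (g ⁻¹)) e ⟩
    act (g ⁻¹) (act g v) ≡⟨ act-cancel g v ⟩
    v                    ∎

  act-adjacent : ∀ g {u v} → u ∼ v → act g u ∼ act g v
  act-adjacent g {u} {v} = subst T (sym (act-adj g u v))

  actQ-arc3 : ∀ g α → IsArc3 Γ α → IsArc3 Γ (actQ g α)
  actQ-arc3 g α (a₀∼a₁ , a₁∼a₂ , a₂∼a₃ , a₀≢a₂ , a₁≢a₃) =
    act-adjacent g a₀∼a₁ , act-adjacent g a₁∼a₂ , act-adjacent g a₂∼a₃ ,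
    a₀≢a₂ ∘ act-injective g , a₁≢a₃ ∘ act-injective g

  orbit-arc3 : ∀ {d} {Δ : Quad Γ → Set d} → IsArc3Orbit A Δ → ∀ α → Δ α → IsArc3 Γ α
  orbit-arc3 (α₀ , α₀-arc , Δ⇔orbit) α α∈Δ with Equivalence.to (Δ⇔orbit α) α∈Δ
  ... | g , refl = actQ-arc3 g α₀ α₀-arc

module Isomorphism (Γ : Graph) (valency4 : HasValency Γ 4) {d : Level} (Δ : Quad Γ → Set d) where
  open Neighbourhoods Γ using (∼-sym)
  open TwoPaths Γ using (rep-swap)
  open Complements Γ valency4

  complements-isJ : ∀ α p q → Rep Γ p (q₀ α) (q₁ α) (q₂ α) → Rep Γ q (q₁ α) (q₂ α) (q₃ α) →
    IsJ Γ α (complement p) (complement q)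
  complements-isJ α p q Rp Rq =
    complementAt-flat (complement-of-rep p Rp) ,
    complementAt-flat (complement-of-rep q (rep-swap {q} Rq))

  -- An ℷ-edge read in the opposite direction is the ℷ-edge of the
  -- reversed 3-arc, which lies in Δ when Δ is self-paired.
  gimel⇒psi : SelfPaired Γ Δ → ∀ p q → GimelAdj Γ Δ p q → PsiAdj Γ Δ (complement p) (complement q)
  gimel⇒psi _ p q (α , α∈Δ , inj₁ (Rp , Rq)) = α , α∈Δ , complements-isJ α p q Rp Rq
  gimel⇒psi self-paired p q (α , α∈Δ , inj₂ (Rq , Rp)) =
    reverseQ Γ α , self-paired α α∈Δ , complements-isJ (reverseQ Γ α) p q (rep-swap {p} Rp) (rep-swap {q} Rq)

  psi⇒gimel : (∀ α → Δ α → IsArc3 Γ α) →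
    ∀ p q → PsiAdj Γ Δ (complement p) (complement q) → GimelAdj Γ Δ p q
  psi⇒gimel arcs p q (α@(⟨ τ₁ , τ , σ , σ₁ ⟩) , α∈Δ , Jp , Jq)
    with arcs α α∈Δ
  ... | τ₁∼τ , τ∼σ , σ∼σ₁ , τ₁≢σ , τ≢σ₁ =
    α , α∈Δ , inj₁
      ( rep-of-complement p (∼-sym τ₁∼τ) τ∼σ τ₁≢σ (flat-complementAt Jp)
      , rep-swap {q} (rep-of-complement q σ∼σ₁ (∼-sym τ∼σ) (τ≢σ₁ ∘ sym) (flat-complementAt Jq)))

theorem6p1 : {c ℓ d : Level} (Γ : Graph) (X : Group c ℓ) (A : GraphAction Γ X) →
    Connected Γ → HasValency Γ 4 → Is2ArcTransitive A →
    (Δ : Quad Γ → Set d) → IsArc3Orbit A Δ → SelfPaired Γ Δ →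
    Isomorphic Γ (GimelAdj Γ Δ) (PsiAdj Γ Δ)
theorem6p1 Γ X A _ valency4 _ Δ Δ-orbit Δ-self-paired =
  complement ,
  involution-bijective complement complement-involutive ,
  λ p q → mk⇔ (gimel⇒psi Δ-self-paired p q) (psi⇒gimel (orbit-arc3 Δ-orbit) p q)
  where
    open Complements Γ valency4 using (complement; complement-involutive)
    open Isomorphism Γ valency4 Δ using (gimel⇒psi; psi⇒gimel)
    open Orbits A using (orbit-arc3)
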